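{- Let $G$ be a group equipped with the profinite topology and let $\mathrm{SBP}$ be the family of subsets of $G$ having the strong Baire property. Then $\mathrm{SBP}$ is a d-closed $G$-algebra.
   Context: The profinite topology on $G$ is generated by cosets of finite-index subgroups. $A\subseteq G$ has the strong Baire property if $\mathrm{int}(A)\cup\mathrm{int}(G\setminus A)$ is dense. A $G$-algebra of subsets of $G$ is a family closed under finite unions, complements and left translations. For an ultrafilter $q$ on $\mathcal P(G)$ and $A\subseteq G$, $d_q(A)=\{h\in G:h^{ -1}A\in q\}$. A $G$-algebra $\mathcal A$ is d-closed if $d_q(A)\in\mathcal A$ for all $A\in\mathcal A$ and all ultrafilters $q$ on $\mathcal P(G)$. -}

module Defs where

open import Level using (Level; _⊔_; suc)
open import Algebra.Bundles using (Group)
open import Data.Nat using (ℕ)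
open import Data.Fin using (Fin)
open import Data.Product using (Σ; ∃; _×_; _,_)
open import Data.Sum using (_⊎_)
open import Data.Empty using (⊥)
open import Data.Unit.Polymorphic using (⊤)
open import Relation.Nullary using (¬_)

module _ {c ℓ : Level} (G : Group c ℓ) where
  open Group G

  Subset : Set (suc c)
  Subset = Carrier → Set c

  _⊆_ : Subset → Subset → Set c
  A ⊆ B = ∀ x → A x → B x

  ∅ : Subset
  ∅ _ = Level.Lift c ⊥

  full : Subset
  full _ = ⊤

  _∪_ : Subset → Subset → Subset
  (A ∪ B) x = A x ⊎ B x

  _∩_ : Subset → Subset → Subset
  (A ∩ B) x = A x × B x

  ∁ : Subset → Subset
  ∁ A x = ¬ A x

  translate : Carrier → Subset → Subset
  translate g A x = A (g ⁻¹ ∙ x)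

  -- h⁻¹ A = { x : h x ∈ A }
  preTranslate : Carrier → Subset → Subset
  preTranslate h A x = A (h ∙ x)

  IsSubgroup : Subset → Set c
  IsSubgroup H = H ε × (∀ x y → H x → H y → H (x ∙ y)) × (∀ x → H x → H (x ⁻¹))

  coset : Carrier → Subset → Subset
  coset g H = translate g H

  FiniteIndex : Subset → Set c
  FiniteIndex H = Σ ℕ λ n → Σ (Fin n → Carrier) λ gs → ∀ x → Σ (Fin n) λ i → coset (gs i) H x

  IsFiniteIndexSubgroup : Subset → Set c
  IsFiniteIndexSubgroup H = IsSubgroup H × FiniteIndex H

  -- profinite topology: the topology generated by cosets of finite-index subgroups
  -- (these cosets form a base, so U is open iff it is a union of such cosets)
  IsOpen : Subset → Set (suc c)
  IsOpen U = ∀ x → U x → Σ Carrier λ g → Σ Subset λ H →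
               IsFiniteIndexSubgroup H × coset g H x × (coset g H ⊆ U)

  int : Subset → Carrier → Set (suc c)
  int A x = Σ Subset λ U → IsOpen U × U x × (U ⊆ A)

  Dense : ∀ {a} → (Carrier → Set a) → Set (suc c ⊔ a)
  Dense D = ∀ (U : Subset) → IsOpen U → (Σ Carrier U) → Σ Carrier λ x → U x × D x

  SBP : Subset → Set (suc c)
  SBP A = Dense (λ x → int A x ⊎ int (∁ A) x)

  record IsUltrafilter (q : Subset → Set c) : Set (suc c) where
    field
      full∈      : q full
      ∅∉         : ¬ q ∅
      upward     : ∀ A B → A ⊆ B → q A → q B
      intersect  : ∀ A B → q A → q B → q (A ∩ B)
      ultra      : ∀ A → q A ⊎ q (∁ A)

  d : (Subset → Set c) → Subset → Subset
  d q A h = q (preTranslate h A)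

  record IsGAlgebra {b} (𝒜 : Subset → Set b) : Set (suc c ⊔ b) where
    field
      ∅-closed         : 𝒜 ∅
      ∪-closed         : ∀ A B → 𝒜 A → 𝒜 B → 𝒜 (A ∪ B)
      ∁-closed         : ∀ A → 𝒜 A → 𝒜 (∁ A)
      translate-closed : ∀ g A → 𝒜 A → 𝒜 (translate g A)

  IsDClosed : ∀ {b} → (Subset → Set b) → Set (suc c ⊔ b)
  IsDClosed 𝒜 = ∀ (q : Subset → Set c) → IsUltrafilter q → ∀ A → 𝒜 A → 𝒜 (d q A)

  IsDClosedGAlgebra : ∀ {b} → (Subset → Set b) → Set (suc c ⊔ b)
  IsDClosedGAlgebra 𝒜 = IsGAlgebra 𝒜 × IsDClosed 𝒜

{-# OPTIONS --safe #-}
-- Translations on either side are homeomorphisms of the profinite topology, and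
-- H ∩ K has finite index when H and K do; this makes SBP a G-algebra.
-- For d-closedness, let gH be a basic open set and He⁻¹ a q-large right coset.
-- The strong Baire property gives y ∈ gHe⁻¹ with yK ⊆ A or yK ⊆ ∁A for some
-- finite-index K. Pick a q-large coset xK with x ∈ He⁻¹: then yx⁻¹ ∈ gH, and every
-- h in the open set yKx⁻¹ satisfies h⁻¹A ⊇ xK (resp. h⁻¹(∁A) ⊇ xK), so yKx⁻¹
-- lies in d_q(A) (resp. in d_q(∁A) ⊆ ∁ d_q(A)).
module Submission where

open import Defs
open import Level using (Level)
open import Algebra.Bundles using (Group)
import Algebra.Properties.Group as GroupProperties
open import Axiom.ExcludedMiddle using (ExcludedMiddle)
open import Data.Nat using (zero; suc; _*_)
open import Data.Fin using (Fin; zero; suc; combine; remQuot)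
open import Data.Fin.Properties using (remQuot-combine)
open import Data.Product using (Σ; _×_; _,_; proj₁; proj₂)
open import Data.Sum using (inj₁; inj₂; [_,_]) renaming (map to ⊎-map)
open import Data.Empty using (⊥-elim)
open import Data.Unit.Polymorphic using (tt)
open import Function using (_∘_)
open import Relation.Nullary using (yes; no)
open import Relation.Binary.PropositionalEquality as ≡ using (_≡_; subst)
import Relation.Binary.Reasoning.Setoid as SetoidReasoning

module ProfiniteTopology {c ℓ : Level} (G : Group c ℓ)
                         (≈⇒≡ : ∀ {x y} → Group._≈_ G x y → x ≡ y) where
  open Group G
  open GroupProperties G
  open SetoidReasoning setoid

  variable
    A B H K U V X : Subset G
    e g x y : Carrier

  ∈-resp-≈ : (A : Subset G) → x ≈ y → A x → A y
  ∈-resp-≈ A = subst A ∘ ≈⇒≡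

  -- the right-handed preTranslate: preTranslateʳ b A = A b⁻¹
  preTranslateʳ : Carrier → Subset G → Subset G
  preTranslateʳ b A x = A (x ∙ b)

  conjugate : Carrier → Subset G → Subset G
  conjugate b H x = H (b ⁻¹ ∙ x ∙ b)

  x∙y∙[y⁻¹∙z]≈x∙z : ∀ x y z → x ∙ y ∙ (y ⁻¹ ∙ z) ≈ x ∙ z
  x∙y∙[y⁻¹∙z]≈x∙z x y z = begin
    x ∙ y ∙ (y ⁻¹ ∙ z)   ≈⟨ assoc x y (y ⁻¹ ∙ z) ⟩
    x ∙ (y ∙ (y ⁻¹ ∙ z)) ≈⟨ ∙-congˡ (\\-leftDividesˡ y z) ⟩
    x ∙ z                ∎

  [x∙y]⁻¹∙[x∙z]≈y⁻¹∙z : ∀ x y z → (x ∙ y) ⁻¹ ∙ (x ∙ z) ≈ y ⁻¹ ∙ z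
  [x∙y]⁻¹∙[x∙z]≈y⁻¹∙z x y z = begin
    (x ∙ y) ⁻¹ ∙ (x ∙ z)     ≈⟨ ∙-congʳ (⁻¹-anti-homo-∙ x y) ⟩
    y ⁻¹ ∙ x ⁻¹ ∙ (x ∙ z)    ≈⟨ assoc (y ⁻¹) (x ⁻¹) (x ∙ z) ⟩
    y ⁻¹ ∙ (x ⁻¹ ∙ (x ∙ z))  ≈⟨ ∙-congˡ (\\-leftDividesʳ x z) ⟩
    y ⁻¹ ∙ z                 ∎

  [x∙y]⁻¹∙[z∙y]≈y⁻¹∙[x⁻¹∙z]∙y : ∀ x y z → (x ∙ y) ⁻¹ ∙ (z ∙ y) ≈ y ⁻¹ ∙ (x ⁻¹ ∙ z) ∙ y
  [x∙y]⁻¹∙[z∙y]≈y⁻¹∙[x⁻¹∙z]∙y x y z = begin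
    (x ∙ y) ⁻¹ ∙ (z ∙ y)     ≈⟨ ∙-congʳ (⁻¹-anti-homo-∙ x y) ⟩
    y ⁻¹ ∙ x ⁻¹ ∙ (z ∙ y)    ≈⟨ assoc (y ⁻¹) (x ⁻¹) (z ∙ y) ⟩
    y ⁻¹ ∙ (x ⁻¹ ∙ (z ∙ y))  ≈⟨ ∙-congˡ (assoc (x ⁻¹) z y) ⟨
    y ⁻¹ ∙ (x ⁻¹ ∙ z ∙ y)    ≈⟨ assoc (y ⁻¹) (x ⁻¹ ∙ z) y ⟨
    y ⁻¹ ∙ (x ⁻¹ ∙ z) ∙ y    ∎

  x∙y∙[z∙y]⁻¹≈x∙z⁻¹ : ∀ x y z → x ∙ y ∙ (z ∙ y) ⁻¹ ≈ x ∙ z ⁻¹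
  x∙y∙[z∙y]⁻¹≈x∙z⁻¹ x y z = begin
    x ∙ y ∙ (z ∙ y) ⁻¹      ≈⟨ ∙-congˡ (⁻¹-anti-homo-∙ z y) ⟩
    x ∙ y ∙ (y ⁻¹ ∙ z ⁻¹)   ≈⟨ x∙y∙[y⁻¹∙z]≈x∙z x y (z ⁻¹) ⟩
    x ∙ z ⁻¹                ∎

  module Conjugation (b : Carrier) where

    φ : Carrier → Carrier
    φ x = b ⁻¹ ∙ x ∙ b

    φ-∙ : ∀ x y → φ x ∙ φ y ≈ φ (x ∙ y)
    φ-∙ x y = begin
      b ⁻¹ ∙ x ∙ b ∙ (b ⁻¹ ∙ y ∙ b)    ≈⟨ assoc (b ⁻¹ ∙ x) b (b ⁻¹ ∙ y ∙ b) ⟩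
      b ⁻¹ ∙ x ∙ (b ∙ (b ⁻¹ ∙ y ∙ b))  ≈⟨ ∙-congˡ (assoc b (b ⁻¹ ∙ y) b) ⟨
      b ⁻¹ ∙ x ∙ (b ∙ (b ⁻¹ ∙ y) ∙ b)  ≈⟨ ∙-congˡ (∙-congʳ (\\-leftDividesˡ b y)) ⟩
      b ⁻¹ ∙ x ∙ (y ∙ b)               ≈⟨ assoc (b ⁻¹ ∙ x) y b ⟨
      b ⁻¹ ∙ x ∙ y ∙ b                 ≈⟨ ∙-congʳ (assoc (b ⁻¹) x y) ⟩
      b ⁻¹ ∙ (x ∙ y) ∙ b               ∎

    φ-ε : φ ε ≈ ε
    φ-ε = trans (∙-congʳ (identityʳ (b ⁻¹))) (inverseˡ b)

    φ-⁻¹ : ∀ x → φ (x ⁻¹) ≈ φ x ⁻¹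
    φ-⁻¹ x = inverseʳ-unique (φ x) (φ (x ⁻¹))
               (trans (φ-∙ x (x ⁻¹)) (trans (∙-congʳ (∙-congˡ (inverseʳ x))) φ-ε))

    φ-inverse : ∀ x → φ (b ∙ x ∙ b ⁻¹) ≈ x
    φ-inverse x = begin
      b ⁻¹ ∙ (b ∙ x ∙ b ⁻¹) ∙ b  ≈⟨ ∙-congʳ (assoc (b ⁻¹) (b ∙ x) (b ⁻¹)) ⟨
      b ⁻¹ ∙ (b ∙ x) ∙ b ⁻¹ ∙ b  ≈⟨ ∙-congʳ (∙-congʳ (\\-leftDividesʳ b x)) ⟩
      x ∙ b ⁻¹ ∙ b               ≈⟨ //-rightDividesˡ b x ⟩
      x                          ∎

  module _ (H-sub : IsSubgroup G H) where
    ε-closed : H ε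
    ε-closed = proj₁ H-sub

    ∙-closed : ∀ x y → H x → H y → H (x ∙ y)
    ∙-closed = proj₁ (proj₂ H-sub)

    ⁻¹-closed : ∀ x → H x → H (x ⁻¹)
    ⁻¹-closed = proj₂ (proj₂ H-sub)

    coset-self : ∀ x → coset G x H x
    coset-self x = ∈-resp-≈ H (sym (inverseˡ x)) ε-closed

    coset-⊆ : coset G g H x → _⊆_ G (coset G x H) (coset G g H)
    coset-⊆ {g} {x} x∈gH z z∈xH =
      ∈-resp-≈ H (x∙y∙[y⁻¹∙z]≈x∙z (g ⁻¹) x z) (∙-closed _ _ x∈gH z∈xH)

    coset-recentre : coset G g H x → _⊆_ G (coset G g H) (coset G x H)
    coset-recentre {g} {x} x∈gH z z∈gH =
      ∈-resp-≈ H ([x∙y]⁻¹∙[x∙z]≈y⁻¹∙z (g ⁻¹) x z) (∙-closed _ _ (⁻¹-closed _ x∈gH) z∈gH)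

    subgroup-⊆ : H x → _⊆_ G (coset G x H) H
    subgroup-⊆ {x} x∈H z z∈xH = ∈-resp-≈ H (\\-leftDividesˡ x z) (∙-closed _ _ x∈H z∈xH)

    conjugate-isSubgroup : ∀ b → IsSubgroup G (conjugate b H)
    conjugate-isSubgroup b =
        ∈-resp-≈ H (sym φ-ε) ε-closed
      , (λ x y x∈ y∈ → ∈-resp-≈ H (φ-∙ x y) (∙-closed _ _ x∈ y∈))
      , (λ x x∈ → ∈-resp-≈ H (sym (φ-⁻¹ x)) (⁻¹-closed _ x∈))
      where open Conjugation b

    conjugate-finiteIndex : ∀ b → FiniteIndex G H → FiniteIndex G (conjugate b H)
    conjugate-finiteIndex b (n , gs , cover) = n , (λ i → b ∙ gs i ∙ b ⁻¹) , cover′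
      where
      open Conjugation b
      cover′ : ∀ y → Σ (Fin n) λ i → coset G (b ∙ gs i ∙ b ⁻¹) (conjugate b H) y
      cover′ y with cover (φ y)
      ... | i , φy∈gᵢH = i , ∈-resp-≈ H (sym eq) φy∈gᵢH
        where
        eq : φ ((b ∙ gs i ∙ b ⁻¹) ⁻¹ ∙ y) ≈ gs i ⁻¹ ∙ φ y
        eq = begin
          φ ((b ∙ gs i ∙ b ⁻¹) ⁻¹ ∙ y)    ≈⟨ φ-∙ _ y ⟨
          φ ((b ∙ gs i ∙ b ⁻¹) ⁻¹) ∙ φ y  ≈⟨ ∙-congʳ (φ-⁻¹ _) ⟩
          φ (b ∙ gs i ∙ b ⁻¹) ⁻¹ ∙ φ y    ≈⟨ ∙-congʳ (⁻¹-cong (φ-inverse (gs i))) ⟩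
          gs i ⁻¹ ∙ φ y                   ∎

  conjugate-isFiniteIndexSubgroup : ∀ b → IsFiniteIndexSubgroup G H →
                                    IsFiniteIndexSubgroup G (conjugate b H)
  conjugate-isFiniteIndexSubgroup b (H-sub , H-fin) =
    conjugate-isSubgroup H-sub b , conjugate-finiteIndex H-sub b H-fin

  ∩-isSubgroup : IsSubgroup G H → IsSubgroup G K → IsSubgroup G (_∩_ G H K)
  ∩-isSubgroup (εH , ∙H , ⁻¹H) (εK , ∙K , ⁻¹K) =
      (εH , εK)
    , (λ x y (xH , xK) (yH , yK) → ∙H x y xH yH , ∙K x y xK yK)
    , (λ x (xH , xK) → ⁻¹H x xH , ⁻¹K x xK)

  -- Each nonempty gᵢH ∩ hⱼK is a coset of H ∩ K; excluded middle decides which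
  -- ones are nonempty, so that a representative can be chosen.
  ∩-finiteIndex : ExcludedMiddle c → IsSubgroup G H → IsSubgroup G K →
                  FiniteIndex G H → FiniteIndex G K → FiniteIndex G (_∩_ G H K)
  ∩-finiteIndex {H} {K} em H-sub K-sub (n , gs , gs-cover) (m , hs , hs-cover) =
    n * m , proj₁ ∘ representative ∘ remQuot m , cover
    where
    Meet : Fin n × Fin m → Subset G
    Meet (i , j) = _∩_ G (coset G (gs i) H) (coset G (hs j) K)

    representative : ∀ ij → Σ Carrier λ z → _⊆_ G (Meet ij) (coset G z (_∩_ G H K))
    representative ij with em {Σ Carrier (Meet ij)}
    ... | yes (z , zH , zK) =
      z , λ y (yH , yK) → coset-recentre H-sub zH y yH , coset-recentre K-sub zK y yK
    ... | no ∄ = ε , λ y y∈ → ⊥-elim (∄ (y , y∈))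

    cover : ∀ y → Σ (Fin (n * m)) λ k → coset G (proj₁ (representative (remQuot m k))) (_∩_ G H K) y
    cover y with gs-cover y | hs-cover y
    ... | i , yH | j , yK =
      combine i j ,
      subst (λ ij → coset G (proj₁ (representative ij)) (_∩_ G H K) y)
            (≡.sym (remQuot-combine i j))
            (proj₂ (representative (i , j)) y (yH , yK))

  ∩-isFiniteIndexSubgroup : ExcludedMiddle c → IsFiniteIndexSubgroup G H →
                            IsFiniteIndexSubgroup G K → IsFiniteIndexSubgroup G (_∩_ G H K)
  ∩-isFiniteIndexSubgroup em (H-sub , H-fin) (K-sub , K-fin) =
    ∩-isSubgroup H-sub K-sub , ∩-finiteIndex em H-sub K-sub H-fin K-fin

  full-isFiniteIndexSubgroup : IsFiniteIndexSubgroup G (full G)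
  full-isFiniteIndexSubgroup =
    (tt , (λ _ _ _ _ → tt) , λ _ _ → tt) , 1 , (λ _ → ε) , λ _ → zero , tt

  CosetNeighbourhood : Subset G → Carrier → Set (Level.suc c)
  CosetNeighbourhood U x = Σ (Subset G) λ K → IsFiniteIndexSubgroup G K × _⊆_ G (coset G x K) U

  isOpen⇒cosetNeighbourhood : IsOpen G U → U x → CosetNeighbourhood U x
  isOpen⇒cosetNeighbourhood U-open x∈U with U-open _ x∈U
  ... | g , K , K-fi , x∈gK , gK⊆U = K , K-fi , λ z z∈xK → gK⊆U z (coset-⊆ (proj₁ K-fi) x∈gK z z∈xK)

  cosetNeighbourhoods⇒isOpen : (∀ x → U x → CosetNeighbourhood U x) → IsOpen G U
  cosetNeighbourhoods⇒isOpen nbhd x x∈U with nbhd x x∈U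
  ... | K , K-fi , xK⊆U = x , K , K-fi , coset-self (proj₁ K-fi) x , xK⊆U

  full-isOpen : IsOpen G (full G)
  full-isOpen = cosetNeighbourhoods⇒isOpen λ _ _ → full G , full-isFiniteIndexSubgroup , λ _ _ → tt

  subgroup-isOpen : IsFiniteIndexSubgroup G H → IsOpen G H
  subgroup-isOpen {H} H-fi = cosetNeighbourhoods⇒isOpen λ x x∈H → H , H-fi , subgroup-⊆ (proj₁ H-fi) x∈H

  ∩-isOpen : ExcludedMiddle c → IsOpen G U → IsOpen G V → IsOpen G (_∩_ G U V)
  ∩-isOpen {U} {V} em U-open V-open = cosetNeighbourhoods⇒isOpen nbhd
    where
    nbhd : ∀ x → _∩_ G U V x → CosetNeighbourhood (_∩_ G U V) x
    nbhd x (x∈U , x∈V) with isOpen⇒cosetNeighbourhood U-open x∈U | isOpen⇒cosetNeighbourhood V-open x∈V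
    ... | H , H-fi , xH⊆U | K , K-fi , xK⊆V =
      _∩_ G H K , ∩-isFiniteIndexSubgroup em H-fi K-fi , λ z (zH , zK) → xH⊆U z zH , xK⊆V z zK

  preTranslate-isOpen : ∀ h → IsOpen G U → IsOpen G (preTranslate G h U)
  preTranslate-isOpen h U-open = cosetNeighbourhoods⇒isOpen λ y hy∈U →
    let K , K-fi , hyK⊆U = isOpen⇒cosetNeighbourhood U-open hy∈U
    in K , K-fi , λ z z∈yK → hyK⊆U (h ∙ z) (∈-resp-≈ K (sym ([x∙y]⁻¹∙[x∙z]≈y⁻¹∙z h y z)) z∈yK)

  -- right translations are continuous because (x b) K = x (b K b⁻¹) b
  preTranslateʳ-isOpen : ∀ b → IsOpen G U → IsOpen G (preTranslateʳ b U)
  preTranslateʳ-isOpen b U-open = cosetNeighbourhoods⇒isOpen λ x xb∈U →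
    let K , K-fi , xbK⊆U = isOpen⇒cosetNeighbourhood U-open xb∈U
    in conjugate b K , conjugate-isFiniteIndexSubgroup b K-fi ,
       λ z z∈x[bKb⁻¹] → xbK⊆U (z ∙ b) (∈-resp-≈ K (sym ([x∙y]⁻¹∙[z∙y]≈y⁻¹∙[x⁻¹∙z]∙y x b z)) z∈x[bKb⁻¹])

  int-mono : _⊆_ G A B → int G A x → int G B x
  int-mono A⊆B (U , U-open , x∈U , U⊆A) = U , U-open , x∈U , λ z → A⊆B z ∘ U⊆A z

  int-∩ : ExcludedMiddle c → int G A x → int G B x → int G (_∩_ G A B) x
  int-∩ em (U , U-open , x∈U , U⊆A) (V , V-open , x∈V , V⊆B) =
    _∩_ G U V , ∩-isOpen em U-open V-open , (x∈U , x∈V) , λ z (z∈U , z∈V) → U⊆A z z∈U , V⊆B z z∈V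

  int⇒cosetNeighbourhood : int G A x → CosetNeighbourhood A x
  int⇒cosetNeighbourhood (U , U-open , x∈U , U⊆A) with isOpen⇒cosetNeighbourhood U-open x∈U
  ... | K , K-fi , xK⊆U = K , K-fi , λ z → U⊆A z ∘ xK⊆U z

  int-preTranslate : ∀ h → int G A y → int G (preTranslate G h A) (h ⁻¹ ∙ y)
  int-preTranslate {y = y} h (U , U-open , y∈U , U⊆A) =
    preTranslate G h U , preTranslate-isOpen h U-open ,
    ∈-resp-≈ U (sym (\\-leftDividesˡ h y)) y∈U , λ z → U⊆A (h ∙ z)

  SBP-∅ : SBP G (∅ G)
  SBP-∅ U _ (u , u∈U) = u , u∈U , inj₂ (full G , full-isOpen , tt , λ _ _ ())

  SBP-∁ : SBP G A → SBP G (∁ G A)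
  SBP-∁ A-sbp U U-open U-nonempty with A-sbp U U-open U-nonempty
  ... | x , x∈U , inj₁ x∈intA  = x , x∈U , inj₂ (int-mono (λ _ a ¬a → ¬a a) x∈intA)
  ... | x , x∈U , inj₂ x∈int∁A = x , x∈U , inj₁ x∈int∁A

  SBP-∪ : ExcludedMiddle c → SBP G A → SBP G B → SBP G (_∪_ G A B)
  SBP-∪ em A-sbp B-sbp U U-open U-nonempty with A-sbp U U-open U-nonempty
  ... | x , x∈U , inj₁ x∈intA = x , x∈U , inj₁ (int-mono (λ _ → inj₁) x∈intA)
  ... | x , x∈U , inj₂ (V , V-open , x∈V , V⊆∁A)
    with B-sbp (_∩_ G U V) (∩-isOpen em U-open V-open) (x , x∈U , x∈V)
  ... | y , (y∈U , _)   , inj₁ y∈intB  = y , y∈U , inj₁ (int-mono (λ _ → inj₂) y∈intB)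
  ... | y , (y∈U , y∈V) , inj₂ y∈int∁B =
    y , y∈U , inj₂ (int-mono (λ _ (¬a , ¬b) → [ ¬a , ¬b ]) (int-∩ em (V , V-open , y∈V , V⊆∁A) y∈int∁B))

  SBP-preTranslate : ∀ h → SBP G A → SBP G (preTranslate G h A)
  SBP-preTranslate h A-sbp U U-open (u , u∈U)
    with A-sbp (preTranslate G (h ⁻¹) U) (preTranslate-isOpen (h ⁻¹) U-open)
               (h ∙ u , ∈-resp-≈ U (sym (\\-leftDividesʳ h u)) u∈U)
  ... | y , h⁻¹y∈U , y∈int = h ⁻¹ ∙ y , h⁻¹y∈U , ⊎-map (int-preTranslate h) (int-preTranslate h) y∈int

  module _ {q : Subset G → Set c} (q-uf : IsUltrafilter G q) where
    open IsUltrafilter q-uf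

    ∈-cover : ∀ {n} (S : Fin n → Subset G) → q X →
              (∀ x → X x → Σ (Fin n) λ i → S i x) → Σ (Fin n) λ i → q (S i)
    ∈-cover {X} {zero} S X∈q cover = ⊥-elim (∅∉ (upward X (∅ G) X⊆∅ X∈q))
      where
      X⊆∅ : _⊆_ G X (∅ G)
      X⊆∅ x x∈X with cover x x∈X
      ... | () , _
    ∈-cover {X} {suc n} S X∈q cover with ultra (S zero)
    ... | inj₁ S₀∈q = zero , S₀∈q
    ... | inj₂ ∁S₀∈q =
      let i , Sᵢ₊₁∈q = ∈-cover (S ∘ suc) (intersect _ _ X∈q ∁S₀∈q) cover′ in suc i , Sᵢ₊₁∈q
      where
      cover′ : ∀ x → _∩_ G X (∁ G (S zero)) x → Σ (Fin n) λ i → S (suc i) x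
      cover′ x (x∈X , x∉S₀) with cover x x∈X
      ... | zero  , x∈S₀  = ⊥-elim (x∉S₀ x∈S₀)
      ... | suc i , x∈Sᵢ₊₁ = i , x∈Sᵢ₊₁

    ∈⇒nonempty : ExcludedMiddle c → q X → Σ Carrier X
    ∈⇒nonempty {X} em X∈q with em {Σ Carrier X}
    ... | yes witness = witness
    ... | no ∄ = ⊥-elim (∅∉ (upward X (∅ G) (λ x x∈X → ⊥-elim (∄ (x , x∈X))) X∈q))

    d-∁⊆∁-d : _⊆_ G (d G q (∁ G A)) (∁ G (d G q A))
    d-∁⊆∁-d h ∁A∈q A∈q = ∅∉ (upward _ (∅ G) (λ _ (a , ¬a) → ⊥-elim (¬a a)) (intersect _ _ A∈q ∁A∈q))

    coset-∈ : ExcludedMiddle c → IsFiniteIndexSubgroup G K → q X →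
              Σ Carrier λ x → X x × q (coset G x K)
    coset-∈ {K} em (K-sub , n , gs , cover) X∈q =
      let i , gᵢK∈q = ∈-cover (λ i → coset G (gs i) K) full∈ (λ x _ → cover x)
          x , x∈gᵢK , x∈X = ∈⇒nonempty em (intersect _ _ gᵢK∈q X∈q)
      in x , x∈X , upward _ _ (coset-recentre K-sub x∈gᵢK) gᵢK∈q

    rightCoset-∈ : IsFiniteIndexSubgroup G H → Σ Carrier λ e → q (preTranslateʳ e H)
    rightCoset-∈ {H} (H-sub , n , gs , cover) =
      let i , Hgᵢ⁻¹∈q = ∈-cover (λ i → preTranslateʳ (gs i) H) full∈ (λ x _ → rightCover x)
      in gs i , Hgᵢ⁻¹∈q
      where
      rightCover : ∀ x → Σ (Fin n) λ i → H (x ∙ gs i)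
      rightCover x with cover (x ⁻¹)
      ... | i , x⁻¹∈gᵢH = i , ∈-resp-≈ H eq (⁻¹-closed H-sub _ x⁻¹∈gᵢH)
        where
        eq : (gs i ⁻¹ ∙ x ⁻¹) ⁻¹ ≈ x ∙ gs i
        eq = trans (⁻¹-anti-homo-∙ (gs i ⁻¹) (x ⁻¹)) (∙-cong (⁻¹-involutive x) (⁻¹-involutive (gs i)))

    int⇒int-d : ExcludedMiddle c → q X → int G B y → Σ Carrier λ x → X x × int G (d G q B) (y ∙ x ⁻¹)
    int⇒int-d {X} {B} {y} em X∈q y∈intB with int⇒cosetNeighbourhood y∈intB
    ... | K , K-fi@(K-sub , _) , yK⊆B with coset-∈ em K-fi X∈q
    ... | x , x∈X , xK∈q = x , x∈X , yKx⁻¹ , yKx⁻¹-open , yx⁻¹∈yKx⁻¹ , yKx⁻¹⊆dB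
      where
      yKx⁻¹ : Subset G
      yKx⁻¹ = preTranslate G (y ⁻¹) (preTranslateʳ x K)

      yKx⁻¹-open : IsOpen G yKx⁻¹
      yKx⁻¹-open = preTranslate-isOpen (y ⁻¹) (preTranslateʳ-isOpen x (subgroup-isOpen K-fi))

      yx⁻¹∈yKx⁻¹ : yKx⁻¹ (y ∙ x ⁻¹)
      yx⁻¹∈yKx⁻¹ = ∈-resp-≈ K (sym (trans (∙-congʳ (\\-leftDividesʳ y (x ⁻¹))) (inverseˡ x)))
                              (ε-closed K-sub)

      yKx⁻¹⊆dB : _⊆_ G yKx⁻¹ (d G q B)
      yKx⁻¹⊆dB h h∈yKx⁻¹ = upward _ _ xK⊆h⁻¹B xK∈q
        where
        xK⊆h⁻¹B : _⊆_ G (coset G x K) (preTranslate G h B)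
        xK⊆h⁻¹B z z∈xK = yK⊆B (h ∙ z) (∈-resp-≈ K eq (∙-closed K-sub _ _ h∈yKx⁻¹ z∈xK))
          where
          eq : y ⁻¹ ∙ h ∙ x ∙ (x ⁻¹ ∙ z) ≈ y ⁻¹ ∙ (h ∙ z)
          eq = trans (x∙y∙[y⁻¹∙z]≈x∙z (y ⁻¹ ∙ h) x z) (assoc (y ⁻¹) h z)

    int⇒int-d-in-coset : ExcludedMiddle c → IsSubgroup G H → q (preTranslateʳ e H) →
                     H (g ⁻¹ ∙ y ∙ e) → int G B y → Σ Carrier λ z → coset G g H z × int G (d G q B) z
    int⇒int-d-in-coset {H} {e} {g} {y} em H-sub He⁻¹∈q y∈gHe⁻¹ y∈intB =
      let x , xe∈H , yx⁻¹∈int = int⇒int-d em He⁻¹∈q y∈intB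
      in y ∙ x ⁻¹ , ∈-resp-≈ H eq (∙-closed H-sub _ _ y∈gHe⁻¹ (⁻¹-closed H-sub _ xe∈H)) , yx⁻¹∈int
      where
      eq : ∀ {x} → g ⁻¹ ∙ y ∙ e ∙ (x ∙ e) ⁻¹ ≈ g ⁻¹ ∙ (y ∙ x ⁻¹)
      eq {x} = trans (x∙y∙[z∙y]⁻¹≈x∙z⁻¹ (g ⁻¹ ∙ y) e x) (assoc (g ⁻¹) y (x ⁻¹))

    SBP-d : ExcludedMiddle c → SBP G A → SBP G (d G q A)
    SBP-d {A} em A-sbp W W-open (w , w∈W) with W-open w w∈W
    ... | g , H , H-fi@(H-sub , _) , w∈gH , gH⊆W with rightCoset-∈ H-fi
    ... | e , He⁻¹∈q with A-sbp gHe⁻¹ gHe⁻¹-open (w ∙ e ⁻¹ , we⁻¹∈gHe⁻¹)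
      where
      gHe⁻¹ : Subset G
      gHe⁻¹ = preTranslate G (g ⁻¹) (preTranslateʳ e H)
      gHe⁻¹-open : IsOpen G gHe⁻¹
      gHe⁻¹-open = preTranslate-isOpen (g ⁻¹) (preTranslateʳ-isOpen e (subgroup-isOpen H-fi))
      we⁻¹∈gHe⁻¹ : gHe⁻¹ (w ∙ e ⁻¹)
      we⁻¹∈gHe⁻¹ = ∈-resp-≈ H (sym (trans (assoc (g ⁻¹) (w ∙ e ⁻¹) e) (∙-congˡ (//-rightDividesˡ e w))))
                              w∈gH
    ... | y , y∈gHe⁻¹ , inj₁ y∈intA =
      let z , z∈gH , z∈int = int⇒int-d-in-coset em H-sub He⁻¹∈q y∈gHe⁻¹ y∈intA
      in z , gH⊆W z z∈gH , inj₁ z∈int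
    ... | y , y∈gHe⁻¹ , inj₂ y∈int∁A =
      let z , z∈gH , z∈int = int⇒int-d-in-coset em H-sub He⁻¹∈q y∈gHe⁻¹ y∈int∁A
      in z , gH⊆W z z∈gH , inj₂ (int-mono (d-∁⊆∁-d {A = A}) z∈int)

proposition4p4 : (∀ {a} → ExcludedMiddle a) →
    ∀ {c ℓ : Level} (G : Group c ℓ) →
      (∀ {x y} → Group._≈_ G x y → x ≡ y) →
      IsDClosedGAlgebra G (SBP G)
proposition4p4 em G ≈⇒≡ =
    record
      { ∅-closed         = SBP-∅
      ; ∪-closed         = λ _ _ → SBP-∪ em
      ; ∁-closed         = λ _ → SBP-∁
      ; translate-closed = λ g _ → SBP-preTranslate (g ⁻¹)
      }
  , λ _ q-uf _ → SBP-d q-uf em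
  where
  open ProfiniteTopology G ≈⇒≡
  open Group G using (_⁻¹)
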